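{- For every letter $n\ge 0$, $L(nn)=n\,L(n)$.
   Context: Words are over $\mathbb{N}=\{0,1,2,\dots\}$. A square is a nonempty word $yy$. For words $u,v$, $u\prec v$ means there is $i$ with $u[:i]=v[:i]$ and $u[i]<v[i]$ ($u[:i]$ the prefix of length $i$, $u[i]$ the letter at position $i$, indexing from $0$). For a finite word $w$ (not necessarily square-free), $L(w)$ is the lexicographically least infinite word over $\mathbb{N}$ that begins with $w$ and whose only square factors are contained in the prefix $w$. Here $nn$ denotes the two-letter word with both letters equal to $n$. -}

module Defs where

open import Data.Nat using (ℕ; zero; suc; _+_; _*_; _<_; _≤_)
open import Data.List using (List; []; _∷_; length; lookup)
open import Data.Fin using (fromℕ<)
open import Data.Product using (Σ; _×_; ∃-syntax)
open import Relation.Binary.PropositionalEquality using (_≡_)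
open import Relation.Nullary using (¬_)

Word∞ : Set
Word∞ = ℕ → ℕ

_∷∞_ : ℕ → Word∞ → Word∞
(a ∷∞ x) zero    = a
(a ∷∞ x) (suc i) = x i

BeginsWith : List ℕ → Word∞ → Set
BeginsWith w x = (i : ℕ) (p : i < length w) → x i ≡ lookup w (fromℕ< p)

-- x has a square factor yy with |y| = suc k starting at position i,
-- i.e. x[i .. i+2(k+1)) is a square.
SquareAt : Word∞ → ℕ → ℕ → Set
SquareAt x i k = (j : ℕ) → j < suc k → x (i + j) ≡ x (i + suc k + j)

SquaresOnlyIn : List ℕ → Word∞ → Set
SquaresOnlyIn w x = (i k : ℕ) → SquareAt x i k → i + 2 * suc k ≤ length w

Admissible : List ℕ → Word∞ → Set
Admissible w x = BeginsWith w x × SquaresOnlyIn w x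

_≺_ : Word∞ → Word∞ → Set
u ≺ v = ∃[ i ] (((j : ℕ) → j < i → u j ≡ v j) × u i < v i)

IsL : List ℕ → Word∞ → Set
IsL w x = Admissible w x × ((y : Word∞) → Admissible w y → ¬ (y ≺ x))

-- L(n) is built greedily: after the first letter n, each position gets the least
-- letter that completes no square ending there; one exists because a letter larger
-- than all earlier ones cannot repeat. The greedy word is square-free, and a word
-- that first drops below it at a position m completes a square ending at m, so it
-- is lexicographically least. As L(n) begins with n, a square of n L(n) at the
-- front longer than nn would force two equal adjacent letters in L(n); the same
-- deviation argument, shifted by one letter, shows that n L(n) is L(nn).

module Submission where

open import Defs
open import Data.Nat
open import Data.Nat.Properties
open import Data.Nat.Induction using (<-rec)
open import Data.Nat.Tactic.RingSolver using (solve-∀)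
open import Data.List using ([]; _∷_; length)
open import Data.Product using (_×_; _,_; proj₁; proj₂; ∃-syntax)
open import Data.Sum using (inj₁; inj₂)
open import Data.Empty using (⊥-elim)
open import Function using (_∘_)
open import Relation.Nullary using (¬_; Dec; yes; no; ¬?; contradiction)
open import Relation.Nullary.Decidable using (_×-dec_; map′; decidable-stable)
open import Relation.Unary using (Pred; Decidable)
open import Relation.Binary.PropositionalEquality
open ≡-Reasoning

module _ {p} {P : Pred ℕ p} (P? : Decidable P) where

  Smallest : Set p
  Smallest = ∃[ c ] (P c × (∀ d → d < c → ¬ P d))

  smallest-witness : ∀ {c} → P c → Smallest
  smallest-witness {c} = <-rec (λ c → P c → Smallest) step c
    where
    step : ∀ c → (∀ {d} → d < c → P d → Smallest) → P c → Smallest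
    step c smaller pc with anyUpTo? P? c
    ... | yes (d , d<c , pd) = smaller d<c pd
    ... | no none            = c , pc , λ d d<c pd → none (d , d<c , pd)

AgreeBelow : ℕ → Word∞ → Word∞ → Set
AgreeBelow m u v = ∀ p → p < m → u p ≡ v p

SquareFree : Word∞ → Set
SquareFree x = ∀ i k → ¬ SquareAt x i k

SquareEndsAt : Word∞ → ℕ → Set
SquareEndsAt x m = ∃[ i ] ∃[ k ] (i + 2 * suc k ≡ suc m × SquareAt x i k)

i+2[1+k]≡1+[i+1+k+k] : ∀ i k → i + 2 * suc k ≡ suc (i + suc k + k)
i+2[1+k]≡1+[i+1+k+k] = solve-∀

squareEndsAt-last : ∀ {i k m} → i + 2 * suc k ≡ suc m → i + suc k + k ≡ m
squareEndsAt-last {i} {k} end = suc-injective (trans (sym (i+2[1+k]≡1+[i+1+k+k] i k)) end)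

squareAt? : ∀ x i k → Dec (SquareAt x i k)
squareAt? x i k = map′ (λ s j j<1+k → s {j} j<1+k) (λ s {j} j<1+k → s j j<1+k)
  (allUpTo? (λ j → x (i + j) ≟ x (i + suc k + j)) (suc k))

squareEndsAt? : ∀ x m → Dec (SquareEndsAt x m)
squareEndsAt? x m = map′ unbounded bounded
  (anyUpTo? (λ i → anyUpTo? (λ k → (i + 2 * suc k ≟ suc m) ×-dec squareAt? x i k) (suc m)) (suc m))
  where
  unbounded : ∃[ i ] (i < suc m × ∃[ k ] (k < suc m × (i + 2 * suc k ≡ suc m × SquareAt x i k))) →
              SquareEndsAt x m
  unbounded (i , _ , k , _ , square) = i , k , square
  bounded : SquareEndsAt x m →
            ∃[ i ] (i < suc m × ∃[ k ] (k < suc m × (i + 2 * suc k ≡ suc m × SquareAt x i k)))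
  bounded (i , k , end , s) =
      i , s≤s (subst (i ≤_) last (≤-trans (m≤m+n i (suc k)) (m≤m+n _ k)))
    , k , s≤s (subst (k ≤_) last (m≤n+m k (i + suc k)))
    , end , s
    where
    last : i + suc k + k ≡ m
    last = squareEndsAt-last end

noSquareEndsAt0 : ∀ {x} → ¬ SquareEndsAt x 0
noSquareEndsAt0 (i , k , end , _) =
  <⇒≢ (≤-trans (s≤s z≤n) (≤-trans (m≤n+m (suc k) i) (m≤m+n (i + suc k) k)))
      (sym (squareEndsAt-last end))

noSquareEnds⇒squareFree : ∀ {x} → (∀ m → ¬ SquareEndsAt x m) → SquareFree x
noSquareEnds⇒squareFree noEnd i k s = noEnd (i + suc k + k) (i , k , i+2[1+k]≡1+[i+1+k+k] i k , s)

squareEndsAt-resp : ∀ {u v m} → AgreeBelow (suc m) u v → SquareEndsAt u m → SquareEndsAt v m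
squareEndsAt-resp {u} {v} {m} u≡v (i , k , end , s) = i , k , end , λ j j≤k → begin
  v (i + j)          ≡⟨ sym (u≡v (i + j) (s≤s (first≤m j≤k))) ⟩
  u (i + j)          ≡⟨ s j j≤k ⟩
  u (i + suc k + j)  ≡⟨ u≡v (i + suc k + j) (s≤s (second≤m j≤k)) ⟩
  v (i + suc k + j)  ∎
  where
  last : i + suc k + k ≡ m
  last = squareEndsAt-last end
  second≤m : ∀ {j} → j < suc k → i + suc k + j ≤ m
  second≤m (s≤s j≤k) = subst (_ ≤_) last (+-monoʳ-≤ (i + suc k) j≤k)
  first≤m : ∀ {j} → j < suc k → i + j ≤ m
  first≤m {j} j<1+k = ≤-trans (+-monoˡ-≤ j (m≤m+n i (suc k))) (second≤m j<1+k)

shift-squareEndsAt : ∀ {y m} → SquareEndsAt (y ∘ suc) m → SquareEndsAt y (suc m)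
shift-squareEndsAt (i , k , end , s) = suc i , k , cong suc end , s

adjacentSquare : ∀ x p → x p ≡ x (suc p) → SquareAt x p 0
adjacentSquare x p eq zero _ = begin
  x (p + 0)      ≡⟨ cong x (+-identityʳ p) ⟩
  x p            ≡⟨ eq ⟩
  x (suc p)      ≡⟨ cong x (sym (trans (+-identityʳ (p + 1)) (+-comm p 1))) ⟩
  x (p + 1 + 0)  ∎
adjacentSquare x p eq (suc j) (s≤s ())

cut : Word∞ → ℕ → ℕ → Word∞
cut f m c p with p <? m
... | yes _ = f p
... | no _  = c

cut-< : ∀ f {m} c {p} → p < m → cut f m c p ≡ f p
cut-< f {m} c {p} p<m with p <? m
... | yes _   = refl
... | no p≮m  = contradiction p<m p≮m

cut-≥ : ∀ f {m} c {p} → m ≤ p → cut f m c p ≡ c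
cut-≥ f {m} c {p} m≤p with p <? m
... | yes p<m = contradiction m≤p (<⇒≱ p<m)
... | no _    = refl

cut-agrees : ∀ {f y m} → AgreeBelow m f y → AgreeBelow (suc m) (cut f m (y m)) y
cut-agrees {f} {y} {m} f≡y p p≤m with m≤n⇒m<n∨m≡n (s≤s⁻¹ p≤m)
... | inj₁ p<m  = trans (cut-< f (y m) p<m) (f≡y p p<m)
... | inj₂ refl = cut-≥ f {m} (y m) ≤-refl

supBelow : Word∞ → ℕ → ℕ
supBelow f zero    = 0
supBelow f (suc m) = f m ⊔ supBelow f m

≤-supBelow : ∀ f {m p} → p < m → f p ≤ supBelow f m
≤-supBelow f {suc m} p<1+m with m<1+n⇒m<n∨m≡n p<1+m
... | inj₁ p<m  = m≤n⇒m≤o⊔n (f m) (≤-supBelow f p<m)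
... | inj₂ refl = m≤m⊔n (f m) (supBelow f m)

fresh-noSquareEndsAt : ∀ f m → ¬ SquareEndsAt (cut f m (suc (supBelow f m))) m
fresh-noSquareEndsAt f m (i , k , end , s) = <-irrefl repeated (s≤s (≤-supBelow f first<m))
  where
  fresh : ℕ
  fresh = suc (supBelow f m)
  last : i + suc k + k ≡ m
  last = squareEndsAt-last end
  first<m : i + k < m
  first<m = subst (i + k <_) last (subst (_≤ i + suc k + k) (+-suc i k) (m≤m+n (i + suc k) k))
  repeated : f (i + k) ≡ fresh
  repeated = begin
    f (i + k)                      ≡⟨ sym (cut-< f fresh first<m) ⟩
    cut f m fresh (i + k)          ≡⟨ s k ≤-refl ⟩
    cut f m fresh (i + suc k + k)  ≡⟨ cut-≥ f fresh (≤-reflexive (sym last)) ⟩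
    fresh                          ∎

module _ (f : Word∞) (m : ℕ) where

  private
    admissibleLetter : ∃[ c ] ((¬ SquareEndsAt (cut f m c) m) × (∀ d → d < c → ¬ ¬ SquareEndsAt (cut f m d) m))
    admissibleLetter = smallest-witness (λ c → ¬? (squareEndsAt? (cut f m c) m)) (fresh-noSquareEndsAt f m)

  nextLetter : ℕ
  nextLetter = proj₁ admissibleLetter

  nextLetter-noSquareEndsAt : ¬ SquareEndsAt (cut f m nextLetter) m
  nextLetter-noSquareEndsAt = proj₁ (proj₂ admissibleLetter)

  <-nextLetter-squareEndsAt : ∀ {c} → c < nextLetter → SquareEndsAt (cut f m c) m
  <-nextLetter-squareEndsAt {c} c<next =
    decidable-stable (squareEndsAt? (cut f m c) m) (proj₂ (proj₂ admissibleLetter) c c<next)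

isL-criterion : ∀ {w z} → Admissible w z →
                (∀ {m} → length w ≤ m → ∀ y → AgreeBelow m y z → y m < z m → SquareEndsAt y m) →
                IsL w z
isL-criterion {w} {z} (z-begins , z-squares) squareBelow =
  (z-begins , z-squares) , not-below
  where
  not-below : ∀ y → Admissible w y → ¬ (y ≺ z)
  not-below y (y-begins , y-squares) (m , y≡z , y<z) with m <? length w
  ... | yes m<∣w∣ = <-irrefl (trans (y-begins m m<∣w∣) (sym (z-begins m m<∣w∣))) y<z
  ... | no m≮∣w∣ with squareBelow (≮⇒≥ m≮∣w∣) y y≡z y<z
  ...   | i , k , end , s = m≮∣w∣ (subst (_≤ length w) end (y-squares i k s))

squareFree⇒squaresOnlyIn : ∀ {w x} → SquareFree x → SquaresOnlyIn w x
squareFree⇒squaresOnlyIn x-free i k s = ⊥-elim (x-free i k s)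

squareFree⇒squaresOnlyIn-∷∞ : ∀ {x} → SquareFree x → SquaresOnlyIn (x 0 ∷ x 0 ∷ []) (x 0 ∷∞ x)
squareFree⇒squaresOnlyIn-∷∞ x-free (suc i) k s      = ⊥-elim (x-free i k s)
squareFree⇒squaresOnlyIn-∷∞ x-free zero    zero s   = ≤-refl
squareFree⇒squaresOnlyIn-∷∞ {x} x-free zero (suc k) s =
  ⊥-elim (x-free (suc k) 0 (adjacentSquare x (suc k) (begin
    x (suc k)            ≡⟨ cong x (sym (+-identityʳ (suc k))) ⟩
    x (suc k + 0)        ≡⟨ sym (s 0 z<s) ⟩
    x 0                  ≡⟨ s 1 (s<s z<s) ⟩
    x (suc k + 1)        ≡⟨ cong x (+-comm (suc k) 1) ⟩
    x (suc (suc k))      ∎)))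

module Greedy (a : ℕ) where

  mutual
    prefix : ℕ → Word∞
    prefix zero    = λ _ → a
    prefix (suc m) = cut (prefix m) m (greedy m)

    greedy : Word∞
    greedy zero    = a
    greedy (suc m) = nextLetter (prefix (suc m)) (suc m)

  prefix-agrees : ∀ m → AgreeBelow m (prefix m) greedy
  prefix-agrees zero    p ()
  prefix-agrees (suc m) = cut-agrees (prefix-agrees m)

  greedy-noSquareEndsAt : ∀ m → ¬ SquareEndsAt greedy m
  greedy-noSquareEndsAt zero    = noSquareEndsAt0 {greedy}
  greedy-noSquareEndsAt (suc m) =
    nextLetter-noSquareEndsAt (prefix (suc m)) (suc m)
    ∘ squareEndsAt-resp (λ p p≤ → sym (cut-agrees (prefix-agrees (suc m)) p p≤))

  greedy-squareFree : SquareFree greedy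
  greedy-squareFree = noSquareEnds⇒squareFree {greedy} greedy-noSquareEndsAt

  greedy-least : ∀ {m} y → AgreeBelow (suc m) y greedy → y (suc m) < greedy (suc m) →
                 SquareEndsAt y (suc m)
  greedy-least {m} y y≡greedy y<greedy =
    squareEndsAt-resp (cut-agrees (λ p p< → trans (prefix-agrees (suc m) p p<) (sym (y≡greedy p p<))))
      (<-nextLetter-squareEndsAt (prefix (suc m)) (suc m) y<greedy)

  greedy-isL : IsL (a ∷ []) greedy
  greedy-isL = isL-criterion {z = greedy}
    ( (λ { zero _ → refl ; (suc _) (s≤s ()) })
    , squareFree⇒squaresOnlyIn {a ∷ []} {greedy} greedy-squareFree)
    λ { {zero} () ; {suc m} _ → greedy-least }

  ∷∞-greedy-isL : IsL (a ∷ a ∷ []) (a ∷∞ greedy)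
  ∷∞-greedy-isL = isL-criterion {z = a ∷∞ greedy}
    ( (λ { zero _ → refl ; (suc zero) _ → refl ; (suc (suc _)) (s≤s (s≤s ())) })
    , squareFree⇒squaresOnlyIn-∷∞ greedy-squareFree)
    λ { {zero} () ; {suc zero} (s≤s ()) ; {suc (suc m)} _ y y≡ y< →
          shift-squareEndsAt {y} (greedy-least (y ∘ suc) (λ p p< → y≡ (suc p) (s<s p<)) y<) }

theorem5p2 : (n : ℕ) → ∃[ y ] (IsL (n ∷ []) y × IsL (n ∷ n ∷ []) (n ∷∞ y))
theorem5p2 n = greedy , greedy-isL , ∷∞-greedy-isL
  where open Greedy n
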